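{- Let $\mathcal{M}^c=\langle S^c,N^c,V^c\rangle$ be the canonical model for $\mathbf{M}^\Delta$. Then for all formulas $\phi\in\mathcal{L}(\Delta)$ and all $s\in S^c$: $\mathcal{M}^c,s\vDash\phi$ iff $\phi\in s$; i.e. $\phi^{\mathcal{M}^c}=|\phi|$.
   Context: $\mathcal{L}(\Delta)$: $\phi::=p\mid\neg\phi\mid\phi\land\phi\mid\Delta\phi$, $p$ in a countable set $\mathbf{P}$. Neighborhood semantics on $\langle S,N,V\rangle$ ($N:S\to\mathcal{P}(\mathcal{P}(S))$): $\mathcal{M},s\vDash p$ iff $s\in V(p)$; Boolean clauses standard; $\mathcal{M},s\vDash\Delta\phi$ iff $\phi^{\mathcal{M}}\in N(s)$ or $S\setminus\phi^{\mathcal{M}}\in N(s)$, with $\phi^{\mathcal{M}}$ the truth set. $\mathbf{M}^\Delta$ is axiomatized by all propositional tautologies, $\Delta\phi\leftrightarrow\Delta\neg\phi$, $\Delta\phi\to\Delta(\phi\vee\psi)\vee\Delta(\neg\phi\vee\chi)$, modus ponens, and the rule RE$\Delta$ (from $\phi\leftrightarrow\psi$ infer $\Delta\phi\leftrightarrow\Delta\psi$). The canonical model: $S^c$ is the set of maximal $\mathbf{M}^\Delta$-consistent sets; $|\phi|=\{s\in S^c\mid\phi\in s\}$; $N^c(s)=\{|\phi|\mid \Delta(\phi\vee\psi)\in s\text{ for every formula }\psi\}$; $V^c(p)=|p|$. -}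

module Defs where

open import Level using (Level; 0ℓ; Lift) renaming (suc to lsuc; _⊔_ to _⊔ℓ_)
open import Data.Nat using (ℕ)
open import Data.Bool using (Bool; true; false; not; _∧_)
open import Data.List using (List; []; _∷_)
open import Data.List.Relation.Unary.All using (All)
open import Data.Product using (Σ; _×_; _,_; proj₁)
open import Data.Sum using (_⊎_)
open import Relation.Nullary using (¬_)
open import Relation.Binary.PropositionalEquality using (_≡_)
open import Function.Bundles using (_⇔_)

infixr 6 _∧'_
data Formula : Set where
  atom : ℕ → Formula
  ¬'_  : Formula → Formula
  _∧'_ : Formula → Formula → Formula
  Δ    : Formula → Formula

_∨'_ : Formula → Formula → Formula
φ ∨' ψ = ¬' ((¬' φ) ∧' (¬' ψ))

_⇒'_ : Formula → Formula → Formula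
φ ⇒' ψ = ¬' (φ ∧' (¬' ψ))

_⇔'_ : Formula → Formula → Formula
φ ⇔' ψ = (φ ⇒' ψ) ∧' (ψ ⇒' φ)

⊥' : Formula
⊥' = atom 0 ∧' (¬' atom 0)

⊤' : Formula
⊤' = ¬' ⊥'

evalB : (Formula → Bool) → Formula → Bool
evalB v (atom p) = v (atom p)
evalB v (¬' φ)   = not (evalB v φ)
evalB v (φ ∧' ψ) = evalB v φ ∧ evalB v ψ
evalB v (Δ φ)    = v (Δ φ)

Tautology : Formula → Set
Tautology φ = (v : Formula → Bool) → evalB v φ ≡ true

data ⊢_ : Formula → Set where
  taut : ∀ {φ} → Tautology φ → ⊢ φ
  axΔ¬ : ∀ φ → ⊢ (Δ φ ⇔' Δ (¬' φ))
  axM  : ∀ φ ψ χ → ⊢ (Δ φ ⇒' (Δ (φ ∨' ψ) ∨' Δ ((¬' φ) ∨' χ)))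
  mp   : ∀ {φ ψ} → ⊢ (φ ⇒' ψ) → ⊢ φ → ⊢ ψ
  reΔ  : ∀ {φ ψ} → ⊢ (φ ⇔' ψ) → ⊢ (Δ φ ⇔' Δ ψ)

FSet : Set₁
FSet = Formula → Set

_⊆_ : FSet → FSet → Set
Γ ⊆ Θ = ∀ φ → Γ φ → Θ φ

conj : List Formula → Formula
conj []       = ⊤'
conj (φ ∷ φs) = φ ∧' conj φs

Consistent : FSet → Set
Consistent Γ = ¬ (Σ (List Formula) λ φs → All Γ φs × (⊢ (¬' conj φs)))

MaxCons : FSet → Set₁
MaxCons Γ = Consistent Γ × ((Θ : FSet) → Γ ⊆ Θ → Consistent Θ → Θ ⊆ Γ)

record Model (a ℓ : Level) : Set (lsuc (a ⊔ℓ ℓ)) where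
  field
    S : Set a
    N : S → (S → Set ℓ) → Set ℓ
    V : ℕ → S → Set ℓ

open Model public

_,_⊨_ : ∀ {a ℓ} (M : Model a ℓ) → S M → Formula → Set ℓ
M , s ⊨ atom p = V M p s
M , s ⊨ (¬' φ) = ¬ (M , s ⊨ φ)
M , s ⊨ (φ ∧' ψ) = (M , s ⊨ φ) × (M , s ⊨ ψ)
M , s ⊨ Δ φ = N M s (λ t → M , t ⊨ φ) ⊎ N M s (λ t → ¬ (M , t ⊨ φ))

truthSet : ∀ {a ℓ} (M : Model a ℓ) → Formula → S M → Set ℓ
truthSet M φ t = M , t ⊨ φ

Sc : Set₁
Sc = Σ FSet MaxCons

∣_∣ : Formula → Sc → Set
∣ φ ∣ s = proj₁ s φ

-- N^c(s) = { |φ| | Δ(φ ∨ ψ) ∈ s for every ψ };  X = |φ| as extensional set equality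
Nc : Sc → (Sc → Set₁) → Set₁
Nc s X = Σ Formula λ φ →
  ((t : Sc) → X t ⇔ Lift (lsuc 0ℓ) (∣ φ ∣ t)) × ((ψ : Formula) → proj₁ s (Δ (φ ∨' ψ)))

Vc : ℕ → Sc → Set₁
Vc p t = Lift (lsuc 0ℓ) (∣ atom p ∣ t)

canonical : Model (lsuc 0ℓ) (lsuc 0ℓ)
canonical = record { S = Sc ; N = Nc ; V = Vc }

-- A maximal consistent set behaves like a Boolean valuation, which settles the atomic and
-- Boolean cases. For Δφ, a neighbourhood |ψ| ∈ N^c(s) that equals the truth set of φ need not
-- have ψ = φ; Lindenbaum's lemma turns |φ| = |ψ| into ⊢ φ ↔ ψ, and RE with Δ(ψ ∨ ⊥) ∈ s
-- gives Δφ ∈ s. Conversely, if Δφ ∈ s then either Δ(φ ∨ ψ) ∈ s for every ψ, so |φ| ∈ N^c(s),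
-- or some Δ(φ ∨ ψ) ∉ s, and the axiom Δφ → Δ(φ ∨ ψ) ∨ Δ(¬φ ∨ χ) puts |¬φ| into N^c(s).
module Submission where

open import Defs
open import Level using (0ℓ; Lift; lift; lower)
open import Axiom.ExcludedMiddle using (ExcludedMiddle)
open import Function using (_∘_; id)
open import Function.Bundles using (_⇔_; mk⇔; Equivalence)
open import Function.Properties.Equivalence using () renaming (sym to ⇔-sym; trans to ⇔-trans)
open import Data.Nat using (ℕ; zero; suc; _+_; _⊔_; _≤′_; ≤′-refl; ≤′-step)
open import Data.Nat.Properties using (+-identityʳ; m≤m⊔n; m≤n⊔m; ≤⇒≤′)
open import Data.Nat.Binary using (ℕᵇ; zero; 2[1+_]; 1+[2_]; toℕ)
open import Data.Nat.Binary.Properties using (toℕ-injective)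
open import Data.Bool using (Bool; true; false; not; _∧_; T)
open import Data.Bool.Properties using (T-∧; T-≡; ∧-inverseʳ)
open import Data.Fin using (Fin)
open import Data.Vec using (Vec; []; _∷_; lookup; map)
open import Data.Vec.Properties using (lookup-map)
open import Data.List using (List; []; _∷_)
open import Data.List.Properties using (∷-injectiveˡ)
open import Data.List.Relation.Unary.All using (All; []; _∷_) renaming (map to All-map)
open import Data.Product using (Σ-syntax; _×_; _,_; proj₁; proj₂)
open import Data.Product.Function.NonDependent.Propositional using (_×-⇔_)
open import Data.Sum as Sum using (_⊎_; inj₁; inj₂; [_,_])
open import Data.Empty using (⊥-elim)
open import Relation.Nullary using (¬_; yes; no)
open import Relation.Unary using (∅)
open import Relation.Binary.PropositionalEquality using (_≡_; refl; sym; trans; cong; cong₂; subst; module ≡-Reasoning)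

open Equivalence

-- Tautologies by truth tables

infix  7 ¬ₛ_
infixr 6 _∧ₛ_
infix  5 _∨ₛ_
infixr 4 _⇒ₛ_
infix  3 _⇔ₛ_

data Schema (n : ℕ) : Set where
  var  : Fin n → Schema n
  ⊥ₛ   : Schema n
  ¬ₛ_  : Schema n → Schema n
  _∧ₛ_ : Schema n → Schema n → Schema n

_⇒ₛ_ _∨ₛ_ _⇔ₛ_ : ∀ {n} → Schema n → Schema n → Schema n
σ ⇒ₛ τ = ¬ₛ (σ ∧ₛ ¬ₛ τ)
σ ∨ₛ τ = ¬ₛ (¬ₛ σ ∧ₛ ¬ₛ τ)
σ ⇔ₛ τ = (σ ⇒ₛ τ) ∧ₛ (τ ⇒ₛ σ)

𝑎 : ∀ {n} → Schema (suc n)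
𝑎 = var Fin.zero

𝑏 : ∀ {n} → Schema (suc (suc n))
𝑏 = var (Fin.suc Fin.zero)

𝑐 : ∀ {n} → Schema (suc (suc (suc n)))
𝑐 = var (Fin.suc (Fin.suc Fin.zero))

𝑑 : ∀ {n} → Schema (suc (suc (suc (suc n))))
𝑑 = var (Fin.suc (Fin.suc (Fin.suc Fin.zero)))

instantiate : ∀ {n} → Vec Formula n → Schema n → Formula
instantiate ρ (var i)  = lookup ρ i
instantiate ρ ⊥ₛ       = ⊥'
instantiate ρ (¬ₛ σ)   = ¬' instantiate ρ σ
instantiate ρ (σ ∧ₛ τ) = instantiate ρ σ ∧' instantiate ρ τ

⟦_⟧ : ∀ {n} → Schema n → Vec Bool n → Bool
⟦ var i ⟧  a = lookup a i
⟦ ⊥ₛ ⟧     a = false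
⟦ ¬ₛ σ ⟧   a = not (⟦ σ ⟧ a)
⟦ σ ∧ₛ τ ⟧ a = ⟦ σ ⟧ a ∧ ⟦ τ ⟧ a

evalB-instantiate : ∀ {n} v (ρ : Vec Formula n) σ → evalB v (instantiate ρ σ) ≡ ⟦ σ ⟧ (map (evalB v) ρ)
evalB-instantiate v ρ (var i)  = sym (lookup-map i (evalB v) ρ)
evalB-instantiate v ρ ⊥ₛ       = ∧-inverseʳ (v (atom 0))
evalB-instantiate v ρ (¬ₛ σ)   = cong not (evalB-instantiate v ρ σ)
evalB-instantiate v ρ (σ ∧ₛ τ) = cong₂ _∧_ (evalB-instantiate v ρ σ) (evalB-instantiate v ρ τ)

holdsEverywhere : ∀ n → (Vec Bool n → Bool) → Bool
holdsEverywhere zero    f = f []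
holdsEverywhere (suc n) f = holdsEverywhere n (f ∘ (true ∷_)) ∧ holdsEverywhere n (f ∘ (false ∷_))

holdsEverywhere-sound : ∀ n f → T (holdsEverywhere n f) → ∀ a → T (f a)
holdsEverywhere-sound zero    f ok [] = ok
holdsEverywhere-sound (suc n) f ok (true ∷ a)  = holdsEverywhere-sound n _ (proj₁ (to T-∧ ok)) a
holdsEverywhere-sound (suc n) f ok (false ∷ a) = holdsEverywhere-sound n _ (proj₂ (to T-∧ ok)) a

tautology : ∀ {n} (ρ : Vec Formula n) (σ : Schema n) {_ : T (holdsEverywhere n ⟦ σ ⟧)} →
            ⊢ instantiate ρ σ
tautology {n} ρ σ {ok} = taut λ v →
  trans (evalB-instantiate v ρ σ) (to T-≡ (holdsEverywhere-sound n ⟦ σ ⟧ ok (map (evalB v) ρ)))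

_∪_ : FSet → FSet → FSet
(Γ ∪ Θ) φ = Γ φ ⊎ Θ φ

｛_｝ : Formula → FSet
｛ ψ ｝ φ = φ ≡ ψ

premises-∪-｛｝ : ∀ {Γ} B L → All (Γ ∪ ｛ B ｝) L →
                  Σ[ L₀ ∈ List Formula ] All Γ L₀ × ⊢ ((conj L₀ ∧' B) ⇒' conj L)
premises-∪-｛｝ B [] [] = [] , [] , tautology (B ∷ []) (¬ₛ ⊥ₛ ∧ₛ 𝑎 ⇒ₛ ¬ₛ ⊥ₛ)
premises-∪-｛｝ B (φ ∷ L) (inj₁ φ∈Γ ∷ L⊆) with premises-∪-｛｝ B L L⊆
... | L₀ , L₀⊆Γ , ⊢L = φ ∷ L₀ , φ∈Γ ∷ L₀⊆Γ ,
  mp (tautology (conj L₀ ∷ B ∷ conj L ∷ φ ∷ [])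
       ((𝑎 ∧ₛ 𝑏 ⇒ₛ 𝑐) ⇒ₛ ((𝑑 ∧ₛ 𝑎) ∧ₛ 𝑏 ⇒ₛ 𝑑 ∧ₛ 𝑐))) ⊢L
premises-∪-｛｝ B (.B ∷ L) (inj₂ refl ∷ L⊆) with premises-∪-｛｝ B L L⊆
... | L₀ , L₀⊆Γ , ⊢L = L₀ , L₀⊆Γ ,
  mp (tautology (conj L₀ ∷ B ∷ conj L ∷ []) ((𝑎 ∧ₛ 𝑏 ⇒ₛ 𝑐) ⇒ₛ (𝑎 ∧ₛ 𝑏 ⇒ₛ 𝑏 ∧ₛ 𝑐))) ⊢L

Consistent-∪-｛｝ : ∀ {Γ} B → (∀ L₀ → All Γ L₀ → ¬ ⊢ (conj L₀ ⇒' (¬' B))) →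
                   Consistent (Γ ∪ ｛ B ｝)
Consistent-∪-｛｝ B unrefuted (L , L⊆ , ⊢¬L) with premises-∪-｛｝ B L L⊆
... | L₀ , L₀⊆Γ , ⊢L = unrefuted L₀ L₀⊆Γ
  (mp (mp (tautology (conj L₀ ∷ B ∷ conj L ∷ []) ((𝑎 ∧ₛ 𝑏 ⇒ₛ 𝑐) ⇒ₛ ¬ₛ 𝑐 ⇒ₛ 𝑎 ⇒ₛ ¬ₛ 𝑏)) ⊢L) ⊢¬L)

infix 4 _∈_ _∉_

_∈_ : Formula → Sc → Set
φ ∈ s = ∣ φ ∣ s

_∉_ : Formula → Sc → Set
φ ∉ s = ¬ (φ ∈ s)

module MaximalConsistent (s : Sc) where

  private
    consistent : Consistent (proj₁ s)
    consistent = proj₁ (proj₂ s)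

  ∈-unrefuted : ∀ B → (∀ L → All (proj₁ s) L → ¬ ⊢ (conj L ⇒' (¬' B))) → B ∈ s
  ∈-unrefuted B unrefuted =
    proj₂ (proj₂ s) _ (λ _ → inj₁) (Consistent-∪-｛｝ B unrefuted) B (inj₂ refl)

  ⊢⇒∈ : ∀ {A} → ⊢ A → A ∈ s
  ⊢⇒∈ {A} ⊢A = ∈-unrefuted A λ L L⊆s ⊢¬A → consistent (L , L⊆s ,
    mp (mp (tautology (conj L ∷ A ∷ []) ((𝑎 ⇒ₛ ¬ₛ 𝑏) ⇒ₛ 𝑏 ⇒ₛ ¬ₛ 𝑎)) ⊢¬A) ⊢A)

  ∈-mp : ∀ {A B} → A ⇒' B ∈ s → A ∈ s → B ∈ s
  ∈-mp {A} {B} A⇒B∈s A∈s = ∈-unrefuted B λ L L⊆s ⊢¬B →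
    consistent (A ∷ A ⇒' B ∷ L , A∈s ∷ A⇒B∈s ∷ L⊆s ,
      mp (tautology (conj L ∷ A ∷ B ∷ []) ((𝑎 ⇒ₛ ¬ₛ 𝑐) ⇒ₛ ¬ₛ (𝑏 ∧ₛ (𝑏 ⇒ₛ 𝑐) ∧ₛ 𝑎))) ⊢¬B)

  ∈-closed : ∀ {B} L → All (proj₁ s) L → ⊢ (conj L ⇒' B) → B ∈ s
  ∈-closed {B} [] [] ⊢B = ⊢⇒∈ (mp (tautology (B ∷ []) ((¬ₛ ⊥ₛ ⇒ₛ 𝑎) ⇒ₛ 𝑎)) ⊢B)
  ∈-closed {B} (A ∷ L) (A∈s ∷ L⊆s) ⊢B = ∈-mp (∈-closed L L⊆s
    (mp (tautology (A ∷ conj L ∷ B ∷ []) ((𝑎 ∧ₛ 𝑏 ⇒ₛ 𝑐) ⇒ₛ 𝑏 ⇒ₛ 𝑎 ⇒ₛ 𝑐)) ⊢B)) A∈s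

  ∈-¬ : ∀ {A} → ¬' A ∈ s ⇔ A ∉ s
  ∈-¬ {A} = mk⇔
    (λ ¬A∈s A∈s → consistent (A ∷ ¬' A ∷ [] , A∈s ∷ ¬A∈s ∷ [] ,
                              tautology (A ∷ []) (¬ₛ (𝑎 ∧ₛ ¬ₛ 𝑎 ∧ₛ ¬ₛ ⊥ₛ))))
    (λ A∉s → ∈-unrefuted (¬' A) λ L L⊆s ⊢¬¬A → A∉s (∈-closed L L⊆s
      (mp (tautology (conj L ∷ A ∷ []) ((𝑎 ⇒ₛ ¬ₛ ¬ₛ 𝑏) ⇒ₛ 𝑎 ⇒ₛ 𝑏)) ⊢¬¬A)))

  ∈-stable : ∀ {A} → ¬ ¬ (A ∈ s) → A ∈ s
  ∈-stable {A} ¬¬A∈s = ∈-mp (⊢⇒∈ (tautology (A ∷ []) (¬ₛ ¬ₛ 𝑎 ⇒ₛ 𝑎)))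
                           (from ∈-¬ (¬¬A∈s ∘ to ∈-¬))

  ∈-∧ : ∀ {A B} → A ∧' B ∈ s ⇔ (A ∈ s × B ∈ s)
  ∈-∧ {A} {B} = mk⇔
    (λ A∧B∈s → ∈-mp (⊢⇒∈ (tautology (A ∷ B ∷ []) (𝑎 ∧ₛ 𝑏 ⇒ₛ 𝑎))) A∧B∈s ,
               ∈-mp (⊢⇒∈ (tautology (A ∷ B ∷ []) (𝑎 ∧ₛ 𝑏 ⇒ₛ 𝑏))) A∧B∈s)
    (λ (A∈s , B∈s) → ∈-mp (∈-mp (⊢⇒∈ (tautology (A ∷ B ∷ []) (𝑎 ⇒ₛ 𝑏 ⇒ₛ 𝑎 ∧ₛ 𝑏))) A∈s) B∈s)

  ∈-⇒-intro : ∀ {A B} → (A ∈ s → B ∈ s) → A ⇒' B ∈ s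
  ∈-⇒-intro A→B = from ∈-¬ λ A∧¬B∈s →
    let A∈s , ¬B∈s = to ∈-∧ A∧¬B∈s in to ∈-¬ ¬B∈s (A→B A∈s)

  ∈-⇔-intro : ∀ {A B} → A ∈ s ⇔ B ∈ s → A ⇔' B ∈ s
  ∈-⇔-intro A⇔B = from ∈-∧ (∈-⇒-intro (to A⇔B) , ∈-⇒-intro (from A⇔B))

  ⊢⇔⇒∈⇔ : ∀ {A B} → ⊢ (A ⇔' B) → A ∈ s ⇔ B ∈ s
  ⊢⇔⇒∈⇔ ⊢A⇔B = let A⇒B∈s , B⇒A∈s = to ∈-∧ (⊢⇒∈ ⊢A⇔B) in mk⇔ (∈-mp A⇒B∈s) (∈-mp B⇒A∈s)

  ∈-∨-resolve : ∀ {A B} → A ∨' B ∈ s → A ∉ s → B ∈ s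
  ∈-∨-resolve A∨B∈s A∉s = ∈-stable λ B∉s →
    to ∈-¬ A∨B∈s (from ∈-∧ (from ∈-¬ A∉s , from ∈-¬ B∉s))

-- Formulas are written in reverse Polish notation over the bits 2[1+_] and 1+[2_] of ℕᵇ,
-- so that a stack machine reading the bits from the outside in decodes them.

pattern O r = 2[1+ r ]
pattern I r = 1+[2 r ]

incrementsWith : ℕ → ℕᵇ → ℕᵇ
incrementsWith zero    r = r
incrementsWith (suc n) r = incrementsWith n (I r)

encodeWith : Formula → ℕᵇ → ℕᵇ
encodeWith (atom n) r = O (O (incrementsWith n r))
encodeWith (¬' φ)   r = encodeWith φ (O (I (O r)))
encodeWith (φ ∧' ψ) r = encodeWith φ (encodeWith ψ (O (I (I (I r)))))
encodeWith (Δ φ)    r = encodeWith φ (O (I (I (O r))))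

decodeWith : ℕᵇ → List Formula → List Formula
decodeWith zero st = st
decodeWith (I r) (atom k ∷ st) = decodeWith r (atom (suc k) ∷ st)
decodeWith (O (O r)) st = decodeWith r (atom 0 ∷ st)
decodeWith (O (I (O r))) (φ ∷ st) = decodeWith r (¬' φ ∷ st)
decodeWith (O (I (I (O r)))) (φ ∷ st) = decodeWith r (Δ φ ∷ st)
decodeWith (O (I (I (I r)))) (ψ ∷ φ ∷ st) = decodeWith r (φ ∧' ψ ∷ st)
decodeWith _ _ = []

decodeWith-incrementsWith : ∀ n r k st →
  decodeWith (incrementsWith n r) (atom k ∷ st) ≡ decodeWith r (atom (n + k) ∷ st)
decodeWith-incrementsWith zero    r k st = refl
decodeWith-incrementsWith (suc n) r k st = decodeWith-incrementsWith n (I r) k st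

decodeWith-encodeWith : ∀ φ r st → decodeWith (encodeWith φ r) st ≡ decodeWith r (φ ∷ st)
decodeWith-encodeWith (atom n) r st =
  trans (decodeWith-incrementsWith n r 0 st) (cong (λ m → decodeWith r (atom m ∷ st)) (+-identityʳ n))
decodeWith-encodeWith (¬' φ) r st = decodeWith-encodeWith φ _ st
decodeWith-encodeWith (φ ∧' ψ) r st =
  trans (decodeWith-encodeWith φ _ st) (decodeWith-encodeWith ψ _ (φ ∷ st))
decodeWith-encodeWith (Δ φ) r st = decodeWith-encodeWith φ _ st

encode : Formula → ℕ
encode φ = toℕ (encodeWith φ zero)

encode-injective : ∀ {φ ψ} → encode φ ≡ encode ψ → φ ≡ ψ
encode-injective {φ} {ψ} eq = ∷-injectiveˡ (begin
  φ ∷ []                            ≡⟨ decodeWith-encodeWith φ zero [] ⟨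
  decodeWith (encodeWith φ zero) [] ≡⟨ cong (λ c → decodeWith c [])
                                         (toℕ-injective {encodeWith φ zero} {encodeWith ψ zero} eq) ⟩
  decodeWith (encodeWith ψ zero) [] ≡⟨ decodeWith-encodeWith ψ zero [] ⟩
  ψ ∷ []                            ∎)
  where open ≡-Reasoning

-- Lindenbaum's lemma

module Lindenbaum (em : ExcludedMiddle 0ℓ) {Γ : FSet} (Γ-consistent : Consistent Γ) where

  coded : ℕ → FSet
  coded n φ = encode φ ≡ n

  stage : ℕ → FSet
  stage zero    = Γ
  stage (suc n) = stage n ∪ λ φ → coded n φ × Consistent (stage n ∪ coded n)

  stage-consistent : ∀ n → Consistent (stage n)
  stage-consistent zero = Γ-consistent
  stage-consistent (suc n) (L , L⊆ , ⊢¬L) with em {Consistent (stage n ∪ coded n)}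
  ... | yes added-consistent = added-consistent (L , All-map (Sum.map₂ proj₁) L⊆ , ⊢¬L)
  ... | no ¬added-consistent = stage-consistent n
          (L , All-map [ id , (λ (_ , c) → ⊥-elim (¬added-consistent c)) ] L⊆ , ⊢¬L)

  stage-mono : ∀ {m n} → m ≤′ n → stage m ⊆ stage n
  stage-mono ≤′-refl         φ φ∈ = φ∈
  stage-mono (≤′-step m≤′n) φ φ∈ = inj₁ (stage-mono m≤′n φ φ∈)

  limit : FSet
  limit φ = Σ[ n ∈ ℕ ] stage n φ

  All-limit⇒All-stage : ∀ L → All limit L → Σ[ n ∈ ℕ ] All (stage n) L
  All-limit⇒All-stage [] [] = 0 , []
  All-limit⇒All-stage (φ ∷ L) ((m , φ∈) ∷ L⊆) with All-limit⇒All-stage L L⊆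
  ... | n , L⊆stage = m ⊔ n , stage-mono (≤⇒≤′ (m≤m⊔n m n)) φ φ∈
                            ∷ All-map (λ {ψ} → stage-mono (≤⇒≤′ (m≤n⊔m m n)) ψ) L⊆stage

  limit-consistent : Consistent limit
  limit-consistent (L , L⊆ , ⊢¬L) =
    let n , L⊆stage = All-limit⇒All-stage L L⊆ in stage-consistent n (L , L⊆stage , ⊢¬L)

  limit-maximal : ∀ Θ → limit ⊆ Θ → Consistent Θ → Θ ⊆ limit
  limit-maximal Θ limit⊆Θ Θ-consistent φ φ∈Θ = suc (encode φ) , inj₂ (refl , added-consistent)
    where
    added-consistent : Consistent (stage (encode φ) ∪ coded (encode φ))
    added-consistent (L , L⊆ , ⊢¬L) = Θ-consistent (L , All-map (λ {ψ} →
      [ (λ ψ∈ → limit⊆Θ ψ (encode φ , ψ∈)) , (λ eq → subst Θ (sym (encode-injective eq)) φ∈Θ) ])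
      L⊆ , ⊢¬L)

  extension : Sc
  extension = limit , limit-consistent , limit-maximal

  ⊆-extension : Γ ⊆ proj₁ extension
  ⊆-extension φ φ∈Γ = 0 , φ∈Γ

∈-everywhere⇒⊢ : ExcludedMiddle 0ℓ → ∀ {A} → (∀ s → A ∈ s) → ⊢ A
∈-everywhere⇒⊢ em {A} A∈ with em {⊢ A}
... | yes ⊢A = ⊢A
... | no ⊬A =
  ⊥-elim (to (MaximalConsistent.∈-¬ extension) (⊆-extension (¬' A) (inj₂ refl)) (A∈ extension))
  where
  unrefuted : ∀ L → All ∅ L → ¬ ⊢ (conj L ⇒' (¬' (¬' A)))
  unrefuted [] [] ⊢¬¬A = ⊬A (mp (tautology (A ∷ []) ((¬ₛ ⊥ₛ ⇒ₛ ¬ₛ ¬ₛ 𝑎) ⇒ₛ 𝑎)) ⊢¬¬A)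
  open Lindenbaum em (Consistent-∪-｛｝ (¬' A) unrefuted)

Lift-⇔ : ∀ {a ℓ} {A : Set a} → Lift ℓ A ⇔ A
Lift-⇔ = mk⇔ lower lift

¬-⇔ : ∀ {a b} {A : Set a} {B : Set b} → A ⇔ B → (¬ A) ⇔ (¬ B)
¬-⇔ A⇔B = mk⇔ (_∘ from A⇔B) (_∘ to A⇔B)

module _ (em : ExcludedMiddle 0ℓ) where

  ∈⇔-everywhere⇒⊢⇔ : ∀ {A B} → (∀ s → A ∈ s ⇔ B ∈ s) → ⊢ (A ⇔' B)
  ∈⇔-everywhere⇒⊢⇔ A⇔B = ∈-everywhere⇒⊢ em (λ s → MaximalConsistent.∈-⇔-intro s (A⇔B s))

  Nc⇒Δ∈ : ∀ s {X χ} → (∀ t → X t ⇔ χ ∈ t) → Nc s X → Δ χ ∈ s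
  Nc⇒Δ∈ s {χ = χ} X⇔χ (φ , X⇔φ , Δφ∨∈s) = to (⊢⇔⇒∈⇔ (reΔ φ∨⊥⇔χ)) (Δφ∨∈s ⊥')
    where
    open MaximalConsistent s
    χ⇔φ : ⊢ (χ ⇔' φ)
    χ⇔φ = ∈⇔-everywhere⇒⊢⇔ λ t →
      ⇔-trans (⇔-sym (X⇔χ t)) (⇔-trans (X⇔φ t) Lift-⇔)
    φ∨⊥⇔χ : ⊢ ((φ ∨' ⊥') ⇔' χ)
    φ∨⊥⇔χ = mp (tautology (χ ∷ φ ∷ []) ((𝑎 ⇔ₛ 𝑏) ⇒ₛ (𝑏 ∨ₛ ⊥ₛ ⇔ₛ 𝑎))) χ⇔φ

  Δ∈⇒Nc : ∀ s {X Y φ} → (∀ t → X t ⇔ φ ∈ t) → (∀ t → Y t ⇔ ¬' φ ∈ t) →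
          Δ φ ∈ s → Nc s X ⊎ Nc s Y
  Δ∈⇒Nc s {φ = φ} X⇔φ Y⇔¬φ Δφ∈s with em {Σ[ ψ ∈ Formula ] Δ (φ ∨' ψ) ∉ s}
  ... | yes (ψ , Δφ∨ψ∉s) = inj₂ (¬' φ , (λ t → ⇔-trans (Y⇔¬φ t) (⇔-sym Lift-⇔)) ,
          λ χ → ∈-∨-resolve (∈-mp (⊢⇒∈ (axM φ ψ χ)) Δφ∈s) Δφ∨ψ∉s)
    where open MaximalConsistent s
  ... | no ∄ψ = inj₁ (φ , (λ t → ⇔-trans (X⇔φ t) (⇔-sym Lift-⇔)) ,
          λ ψ → ∈-stable λ Δφ∨ψ∉s → ∄ψ (ψ , Δφ∨ψ∉s))
    where open MaximalConsistent s

  truth-¬ : ∀ φ s → (canonical , s ⊨ φ) ⇔ φ ∈ s → (canonical , s ⊨ (¬' φ)) ⇔ ¬' φ ∈ s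
  truth-¬ φ s ih = ⇔-trans (¬-⇔ ih) (⇔-sym (MaximalConsistent.∈-¬ s))

  -- The Δ case applies truth-¬ to the induction hypothesis, since ¬φ is not a subformula of Δφ.
  truth : ∀ φ s → (canonical , s ⊨ φ) ⇔ φ ∈ s
  truth (atom p) s = Lift-⇔
  truth (¬' φ)   s = truth-¬ φ s (truth φ s)
  truth (φ ∧' ψ) s = ⇔-trans (truth φ s ×-⇔ truth ψ s) (⇔-sym (MaximalConsistent.∈-∧ s))
  truth (Δ φ)    s = mk⇔
    [ Nc⇒Δ∈ s (truth φ) , from (MaximalConsistent.⊢⇔⇒∈⇔ s (axΔ¬ φ)) ∘ Nc⇒Δ∈ s truth¬φ ]
    (Δ∈⇒Nc s (truth φ) truth¬φ)
    where
    truth¬φ : ∀ t → (canonical , t ⊨ (¬' φ)) ⇔ ¬' φ ∈ t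
    truth¬φ t = truth-¬ φ t (truth φ t)

mainTheorem11 : ExcludedMiddle 0ℓ →
    (φ : Formula) (s : Sc) → (canonical , s ⊨ φ) ⇔ ∣ φ ∣ s
mainTheorem11 = truth
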